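{- Let $\mathcal{G}=(G,\lambda)$ be a simple temporal clique with vertex set $V$, and let $u,v,w\in V$ with $v\neq u$ and $w\neq u$. If $\{u,v\}=e^-(v)$, then for every vertex $x\in V\setminus\{u\}$ there is a journey from $u$ to $x$ whose first edge is $\{u,v\}$ (i.e., $u$ can reach all vertices through $v$). Symmetrically, if $\{u,w\}=e^+(w)$, then for every vertex $x\in V\setminus\{u\}$ there is a journey from $x$ to $u$ whose last edge is $\{w,u\}$ (i.e., all vertices can reach $u$ through $w$).
   Context: A simple temporal clique is a pair $\mathcal{G}=(G,\lambda)$ where $G=(V,E)$ is the complete graph on a finite vertex set $V$ with $n=|V|\ge 2$, and $\lambda:E\to\mathbb{N}$ assigns to each edge a single label such that any two distinct edges sharing an endpoint have distinct labels. A journey from $x$ to $y$ is a sequence of edges $\{u_1,u_2\},\{u_2,u_3\},\dots,\{u_k,u_{k+1}\}$ with $k\ge 1$, $u_1=x$, $u_{k+1}=y$, the vertices $u_1,\dots,u_{k+1}$ pairwise distinct, and $\lambda(\{u_i,u_{i+1}\})<\lambda(\{u_{i+1},u_{i+2}\})$ for all $1\le i<k$. For a vertex $v$, $e^-(v)$ (resp. $e^+(v)$) denotes the edge incident to $v$ with the smallest (resp. largest) label. -}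

module Defs where

open import Data.Nat using (ℕ; _<_; _≤_; _≥_)
open import Data.Fin using (Fin)
open import Data.List using (List; []; _∷_; length; head; last)
open import Data.List.Relation.Unary.Unique.Propositional using (Unique)
open import Data.Maybe using (Maybe; just)
open import Data.Product using (_×_)
open import Data.Unit using (⊤)
open import Relation.Binary.PropositionalEquality using (_≡_; _≢_)

-- A simple temporal clique on vertex set Fin n: the complete graph with a
-- single label per edge {x,y} (x ≢ y), given as a symmetric function
-- (values on the diagonal x = y are irrelevant and never used),
-- such that adjacent distinct edges have distinct labels.
record TemporalClique (n : ℕ) : Set where
  field
    label     : Fin n → Fin n → ℕ
    label-sym : ∀ x y → label x y ≡ label y x
    proper    : ∀ x y z → x ≢ y → x ≢ z → y ≢ z → label x y ≢ label x z

open TemporalClique public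

Increasing : ∀ {n} → TemporalClique n → List (Fin n) → Set
Increasing G (a ∷ b ∷ c ∷ rest) = label G a b < label G b c × Increasing G (b ∷ c ∷ rest)
Increasing G _ = ⊤

IsJourney : ∀ {n} → TemporalClique n → List (Fin n) → Set
IsJourney G p = length p ≥ 2 × Unique p × Increasing G p

JourneyFromTo : ∀ {n} → TemporalClique n → Fin n → Fin n → List (Fin n) → Set
JourneyFromTo G x y p = IsJourney G p × head p ≡ just x × last p ≡ just y

-- {u,v} = e⁻(v): among edges incident to v, {v,u} has the smallest label
IsMinEdgeAt : ∀ {n} → TemporalClique n → Fin n → Fin n → Set
IsMinEdgeAt G v u = ∀ y → y ≢ v → label G v u ≤ label G v y

-- {u,w} = e⁺(w): among edges incident to w, {w,u} has the largest label
IsMaxEdgeAt : ∀ {n} → TemporalClique n → Fin n → Fin n → Set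
IsMaxEdgeAt G w u = ∀ y → y ≢ w → label G w y ≤ label G w u

module Submission where

-- If {u,v} = e⁻(v), then for any x ∉ {u,v} the edge {v,x} has a
-- label at least λ(u,v), and strictly larger because adjacent edges carry
-- distinct labels; so u, v, x is a journey (and u, v itself when x = v).
-- Dually, if {u,w} = e⁺(w), then x, w, u is a journey.

open import Defs
open import Data.Nat using (ℕ; _≥_; _<_; s≤s; z≤n)
open import Data.Nat.Properties using (≤∧≢⇒<)
open import Data.Fin using (Fin; _≟_)
open import Data.List using (List; []; _∷_; _++_)
open import Data.List.Relation.Unary.All using ([]; _∷_)
open import Data.List.Relation.Unary.AllPairs using ([]; _∷_)
open import Data.Product using (_×_; ∃; _,_)
open import Data.Unit using (tt)
open import Relation.Nullary using (yes; no)
open import Relation.Binary.PropositionalEquality using (_≢_; refl; subst; ≢-sym)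

module _ {n : ℕ} (G : TemporalClique n) where

  edge-journey : ∀ {a b} → a ≢ b → JourneyFromTo G a b (a ∷ b ∷ [])
  edge-journey a≢b = (s≤s (s≤s z≤n) , (a≢b ∷ []) ∷ [] ∷ [] , tt) , refl , refl

  two-edge-journey : ∀ {a b c} → a ≢ b → a ≢ c → b ≢ c →
                     label G a b < label G b c → JourneyFromTo G a c (a ∷ b ∷ c ∷ [])
  two-edge-journey a≢b a≢c b≢c ab<bc =
    (s≤s (s≤s z≤n) , (a≢b ∷ a≢c ∷ []) ∷ (b≢c ∷ []) ∷ [] ∷ [] , ab<bc , tt) , refl , refl

  min-edge-label-< : ∀ {v u y} → IsMinEdgeAt G v u → v ≢ u → y ≢ v → y ≢ u →
                     label G u v < label G v y
  min-edge-label-< {v} {u} {y} min v≢u y≢v y≢u =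
    subst (_< label G v y) (label-sym G v u)
          (≤∧≢⇒< (min y y≢v) (proper G v u y v≢u (≢-sym y≢v) (≢-sym y≢u)))

  max-edge-label-< : ∀ {w u y} → IsMaxEdgeAt G w u → w ≢ u → y ≢ w → y ≢ u →
                     label G y w < label G w u
  max-edge-label-< {w} {u} {y} max w≢u y≢w y≢u =
    subst (_< label G w u) (label-sym G w y)
          (≤∧≢⇒< (max y y≢w) (proper G w y u (≢-sym y≢w) w≢u y≢u))

  reach-through-min-edge : ∀ {u v} → v ≢ u → IsMinEdgeAt G v u →
                           ∀ x → x ≢ u → ∃ λ rest → JourneyFromTo G u x (u ∷ v ∷ rest)
  reach-through-min-edge {u} {v} v≢u min x x≢u with x ≟ v
  ... | yes refl = [] , edge-journey (≢-sym v≢u)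
  ... | no x≢v   = x ∷ [] , two-edge-journey (≢-sym v≢u) (≢-sym x≢u) (≢-sym x≢v)
                                             (min-edge-label-< min v≢u x≢v x≢u)

  reached-through-max-edge : ∀ {u w} → w ≢ u → IsMaxEdgeAt G w u →
                             ∀ x → x ≢ u → ∃ λ rest → JourneyFromTo G x u (rest ++ w ∷ u ∷ [])
  reached-through-max-edge {u} {w} w≢u max x x≢u with x ≟ w
  ... | yes refl = [] , edge-journey w≢u
  ... | no x≢w   = x ∷ [] , two-edge-journey x≢w x≢u w≢u (max-edge-label-< max w≢u x≢w x≢u)

lemma1 : (n : ℕ) → n ≥ 2 → (G : TemporalClique n) → (u v w : Fin n) → v ≢ u → w ≢ u →
         ((IsMinEdgeAt G v u →
            ∀ x → x ≢ u → ∃ λ rest → JourneyFromTo G u x (u ∷ v ∷ rest))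
         × (IsMaxEdgeAt G w u →
            ∀ x → x ≢ u → ∃ λ rest → JourneyFromTo G x u (rest ++ w ∷ u ∷ [])))
lemma1 n _ G u v w v≢u w≢u =
  reach-through-min-edge G v≢u , reached-through-max-edge G w≢u
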